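{- Let $G$ be a minimal non flat path extendable (MNFPE) graph and let $P$ be a witness path for $G$. Then every nearly simplicial vertex of $G$ is in $N[P]$.
   Context: All graphs are finite and simple. A graph is chordal if it contains no induced cycle of length four or more. For a path $P=(v_1,\ldots,v_k)$, $N[P]$ denotes the set of vertices that are in $P$ or have at least one neighbor in $P$, and the interior of $P$ is $\{v_2,\ldots,v_{k-1}\}$ (empty if $k\le 2$). An induced path $P$ is flat if every vertex in its interior has degree 2 in $G$. A graph $G$ is flat path extendable (FPE) if for every induced flat path $P$ and every two sets $W_1,W_2\subseteq V(G)$ with $G[W_1],G[W_2]$ chordal, $W_1\cap W_2=V(P)$ and $W_1\cup W_2=N[P]$, there exist sets $X_1\supseteq W_1$, $X_2\supseteq W_2$ with $G[X_1],G[X_2]$ chordal, $X_1\cap X_2=V(P)$ and $X_1\cup X_2=V(G)$. $G$ is minimal non flat path extendable (MNFPE) if $G$ is not FPE but every proper induced subgraph of $G$ is FPE. A witness path for such $G$ is an induced flat path $P$ for which there are sets $W_1,W_2$ with $G[W_1],G[W_2]$ chordal, $W_1\cap W_2=V(P)$ and $W_1\cup W_2=N[P]$, but no sets $X_1\supseteq W_1$, $X_2\supseteq W_2$ with $G[X_1],G[X_2]$ chordal, $X_1\cap X_2=V(P)$ and $X_1\cup X_2=V(G)$. A vertex $v$ is nearly simplicial if $N(v)$ is the union of a clique and a single vertex. -}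

module Defs where

open import Data.Nat using (ℕ; zero; suc; _≤_)
open import Data.Bool using (Bool; true; false; _∨_)
open import Data.Fin using (Fin; toℕ; _≟_)
open import Data.Fin.Subset using (Subset; _∈_; _∉_; _⊆_; _∩_; _∪_; ⁅_⁆; ∣_∣; ⊤)
open import Data.Vec using (tabulate)
open import Data.Product using (Σ; ∃; ∃-syntax; _×_)
open import Data.Sum using (_⊎_)
open import Relation.Nullary using (¬_)
open import Relation.Nullary.Decidable using (⌊_⌋)
open import Relation.Binary.PropositionalEquality using (_≡_; _≢_)

record Graph : Set where
  field
    n      : ℕ
    adj    : Fin n → Fin n → Bool
    sym    : ∀ u v → adj u v ≡ adj v u
    irrefl : ∀ v → adj v v ≡ false

anyᵇ : ∀ {k} → (Fin k → Bool) → Bool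
anyᵇ {zero}  f = false
anyᵇ {suc k} f = f Fin.zero ∨ anyᵇ (λ i → f (Fin.suc i))

cycleAdjIdx : (k : ℕ) → Fin k → Fin k → Set
cycleAdjIdx k i j =
  suc (toℕ i) ≡ toℕ j ⊎ suc (toℕ j) ≡ toℕ i
  ⊎ (toℕ i ≡ 0 × suc (toℕ j) ≡ k) ⊎ (toℕ j ≡ 0 × suc (toℕ i) ≡ k)

pathAdjIdx : ∀ {m} → Fin m → Fin m → Set
pathAdjIdx i j = suc (toℕ i) ≡ toℕ j ⊎ suc (toℕ j) ≡ toℕ i

module _ (G : Graph) where
  open Graph G

  nbhd : Fin n → Subset n
  nbhd v = tabulate (λ u → adj v u)

  Clique : Subset n → Set
  Clique K = ∀ u v → u ∈ K → v ∈ K → u ≢ v → adj u v ≡ true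

  IsInducedCycle : Subset n → (k : ℕ) → (Fin k → Fin n) → Set
  IsInducedCycle W k c =
    4 ≤ k
    × (∀ i j → c i ≡ c j → i ≡ j)
    × (∀ i → c i ∈ W)
    × (∀ i j → (adj (c i) (c j) ≡ true → cycleAdjIdx k i j)
             × (cycleAdjIdx k i j → adj (c i) (c j) ≡ true))

  Chordal : Subset n → Set
  Chordal W = ∀ k (c : Fin k → Fin n) → ¬ IsInducedCycle W k c

  -- Paths P = (p 0, ..., p k) with k+1 ≥ 1 vertices.
  -- induced path of G[U]
  IsInducedPath : Subset n → (k : ℕ) → (Fin (suc k) → Fin n) → Set
  IsInducedPath U k p =
    (∀ i j → p i ≡ p j → i ≡ j)
    × (∀ i → p i ∈ U)
    × (∀ i j → (adj (p i) (p j) ≡ true → pathAdjIdx i j)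
             × (pathAdjIdx i j → adj (p i) (p j) ≡ true))

  degIn : Subset n → Fin n → ℕ
  degIn U v = ∣ U ∩ nbhd v ∣

  IsInducedFlatPath : Subset n → (k : ℕ) → (Fin (suc k) → Fin n) → Set
  IsInducedFlatPath U k p =
    IsInducedPath U k p
    × (∀ i → 1 ≤ toℕ i → suc (toℕ i) ≤ k → degIn U (p i) ≡ 2)

  VP : (k : ℕ) → (Fin (suc k) → Fin n) → Subset n
  VP k p = tabulate (λ v → anyᵇ (λ i → ⌊ p i ≟ v ⌋))

  NP : Subset n → (k : ℕ) → (Fin (suc k) → Fin n) → Subset n
  NP U k p = U ∩ tabulate (λ v → anyᵇ (λ i → ⌊ p i ≟ v ⌋ ∨ adj (p i) v))

  GoodPair : Subset n → (k : ℕ) → (Fin (suc k) → Fin n) → Subset n → Subset n → Set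
  GoodPair U k p W₁ W₂ =
    Chordal W₁ × Chordal W₂ × (W₁ ∩ W₂ ≡ VP k p) × (W₁ ∪ W₂ ≡ NP U k p)

  Extendable : Subset n → (k : ℕ) → (Fin (suc k) → Fin n) → Subset n → Subset n → Set
  Extendable U k p W₁ W₂ =
    Σ (Subset n) λ X₁ → Σ (Subset n) λ X₂ →
      W₁ ⊆ X₁ × W₂ ⊆ X₂ × Chordal X₁ × Chordal X₂
      × (X₁ ∩ X₂ ≡ VP k p) × (X₁ ∪ X₂ ≡ U)

  FPE : Subset n → Set
  FPE U = ∀ k (p : Fin (suc k) → Fin n) → IsInducedFlatPath U k p →
          ∀ W₁ W₂ → GoodPair U k p W₁ W₂ → Extendable U k p W₁ W₂

  MNFPE : Set
  MNFPE = ¬ FPE ⊤ × (∀ U → (∃[ v ] v ∉ U) → FPE U)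

  WitnessPath : (k : ℕ) → (Fin (suc k) → Fin n) → Set
  WitnessPath k p =
    IsInducedFlatPath ⊤ k p
    × (Σ (Subset n) λ W₁ → Σ (Subset n) λ W₂ →
         GoodPair ⊤ k p W₁ W₂ × ¬ Extendable ⊤ k p W₁ W₂)

  NearlySimplicial : Fin n → Set
  NearlySimplicial v = Σ (Subset n) λ K → Σ (Fin n) λ x → Clique K × (nbhd v ≡ K ∪ ⁅ x ⁆)

{-# OPTIONS --safe #-}
-- Suppose v ∉ N[P]. Then P is still an induced flat path of G − v with the same N[P], so by minimality
-- (W₁, W₂) extends to X₁, X₂ covering G − v. Write N(v) = K ∪ {x} with K a clique. As v has no neighbour
-- on P, x ∉ V(P) = X₁ ∩ X₂, so some Xᵢ misses x; then v is simplicial in G[Xᵢ ∪ {v}], and adding a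
-- simplicial vertex to a chordal graph keeps it chordal. So (W₁, W₂) extends in G after all, which
-- contradicts P being a witness path.
module Submission where

open import Defs
open import Data.Nat using (ℕ; suc; _+_; _<_; _≤_; s≤s; z≤n) renaming (_≟_ to _≟ℕ_)
open import Data.Nat.Properties using (suc-injective; ≤∧≢⇒<; n≤1+n; ≤-trans; ≤-refl; 1+n≢n; m≢1+n+m)
open import Data.Bool using (Bool; true; false; _∨_)
open import Data.Fin using (Fin; toℕ; fromℕ<; _≟_)
open import Data.Fin.Properties using (toℕ<n; toℕ-fromℕ<)
open import Data.Fin.Subset using (Subset; _∈_; _∉_; _⊆_; _∩_; _∪_; ⁅_⁆; ∁; ∣_∣; ⊤)
open import Data.Fin.Subset.Properties
  using (_∈?_; ∈⊤; x∈⁅x⁆; x∈⁅y⁆⇒x≡y; x∈p∩q⁺; x∈p∩q⁻; x∈p∪q⁻; p⊆p∪q; q⊆p∪q; p∩q⊆q;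
         ⊆-antisym; ∩-comm; ∩-identityˡ; ∪-assoc; ∪-comm; p∪∁p≡⊤; x∈p⇒x∉∁p; x∉p⇒x∈∁p; x≢y⇒x∉⁅y⁆)
open import Data.Vec using (tabulate)
open import Data.Vec.Properties using (lookup∘tabulate; []=⇒lookup; lookup⇒[]=)
open import Data.Product using (∃; ∃₂; _×_; _,_; proj₁; proj₂)
open import Data.Sum using (_⊎_; inj₁; inj₂)
open import Function using (_∘_)
open import Relation.Nullary using (¬_; yes; no)
open import Relation.Nullary.Decidable using (⌊_⌋; decidable-stable)
open import Relation.Binary.PropositionalEquality using (_≡_; _≢_; refl; sym; trans; cong; subst; subst₂)

-- cycleAdjIdx k i j is definitionally CycleAdjacent k (toℕ i) (toℕ j).
CycleAdjacent : ℕ → ℕ → ℕ → Set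
CycleAdjacent k a b = suc a ≡ b ⊎ suc b ≡ a ⊎ (a ≡ 0 × suc b ≡ k) ⊎ (b ≡ 0 × suc a ≡ k)

-- The witnesses are a ∓ 1 (mod k); they are not adjacent because k ≥ 4.
cycle-neighboursℕ : ∀ {k a} → 4 ≤ k → a < k →
  ∃₂ λ b₁ b₂ → b₁ < k × b₂ < k × CycleAdjacent k a b₁ × CycleAdjacent k a b₂
               × b₁ ≢ b₂ × ¬ CycleAdjacent k b₁ b₂
cycle-neighboursℕ {suc (suc (suc (suc m)))} {0} (s≤s (s≤s (s≤s (s≤s z≤n)))) _ =
  1 , 3 + m , s≤s (s≤s z≤n) , ≤-refl , inj₁ refl , inj₂ (inj₂ (inj₁ (refl , refl))) , (λ ()) , apart
  where
  apart : ¬ CycleAdjacent (4 + m) 1 (3 + m)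
  apart (inj₁ ())
  apart (inj₂ (inj₁ ()))
  apart (inj₂ (inj₂ (inj₁ (() , _))))
  apart (inj₂ (inj₂ (inj₂ (() , _))))
cycle-neighboursℕ {suc (suc (suc (suc m)))} {suc a} (s≤s (s≤s (s≤s (s≤s z≤n)))) a<k with a ≟ℕ 2 + m
... | yes refl =
  0 , 2 + m , s≤s z≤n , s≤s (s≤s (s≤s (n≤1+n m))) , inj₂ (inj₂ (inj₂ (refl , refl))) , inj₂ (inj₁ refl)
  , (λ ()) , apart
  where
  apart : ¬ CycleAdjacent (4 + m) 0 (2 + m)
  apart (inj₁ ())
  apart (inj₂ (inj₁ ()))
  apart (inj₂ (inj₂ (inj₁ (_ , e)))) = 1+n≢n (sym e)
  apart (inj₂ (inj₂ (inj₂ (() , _))))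
... | no a≢2+m =
  2 + a , a , ≤∧≢⇒< a<k (a≢2+m ∘ suc-injective ∘ suc-injective) , ≤-trans (n≤1+n (suc a)) a<k
  , inj₁ refl , inj₂ (inj₁ refl) , m≢1+n+m a {1} ∘ sym , apart
  where
  apart : ¬ CycleAdjacent (4 + m) (2 + a) a
  apart (inj₁ e) = m≢1+n+m a {2} (sym e)
  apart (inj₂ (inj₁ e)) = 1+n≢n (sym e)
  apart (inj₂ (inj₂ (inj₁ (() , _))))
  apart (inj₂ (inj₂ (inj₂ (refl , ()))))

cycle-neighbours : ∀ {k} → 4 ≤ k → (i : Fin k) →
  ∃₂ λ (j₁ j₂ : Fin k) → cycleAdjIdx k i j₁ × cycleAdjIdx k i j₂ × j₁ ≢ j₂ × ¬ cycleAdjIdx k j₁ j₂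
cycle-neighbours {k} 4≤k i
  with b₁ , b₂ , b₁<k , b₂<k , i~b₁ , i~b₂ , b₁≢b₂ , b₁≁b₂ ← cycle-neighboursℕ 4≤k (toℕ<n i) =
  fromℕ< b₁<k , fromℕ< b₂<k
  , subst (CycleAdjacent k (toℕ i)) (sym (toℕ-fromℕ< b₁<k)) i~b₁
  , subst (CycleAdjacent k (toℕ i)) (sym (toℕ-fromℕ< b₂<k)) i~b₂
  , (λ j₁≡j₂ → b₁≢b₂ (trans (sym (toℕ-fromℕ< b₁<k)) (trans (cong toℕ j₁≡j₂) (toℕ-fromℕ< b₂<k))))
  , b₁≁b₂ ∘ subst₂ (CycleAdjacent k) (toℕ-fromℕ< b₁<k) (toℕ-fromℕ< b₂<k)

∈-tabulate⁺ : ∀ {n} (f : Fin n → Bool) {x} → f x ≡ true → x ∈ tabulate f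
∈-tabulate⁺ f {x} fx = lookup⇒[]= x (tabulate f) (trans (lookup∘tabulate f x) fx)

∈-tabulate⁻ : ∀ {n} (f : Fin n → Bool) {x} → x ∈ tabulate f → f x ≡ true
∈-tabulate⁻ f {x} x∈ = trans (sym (lookup∘tabulate f x)) ([]=⇒lookup x∈)

anyᵇ⁺ : ∀ {k} (f : Fin k → Bool) i → f i ≡ true → anyᵇ f ≡ true
anyᵇ⁺ f Fin.zero fi rewrite fi = refl
anyᵇ⁺ f (Fin.suc i) fi with f Fin.zero
... | true = refl
... | false = anyᵇ⁺ (f ∘ Fin.suc) i fi

anyᵇ⁻ : ∀ {k} (f : Fin k → Bool) → anyᵇ f ≡ true → ∃ λ i → f i ≡ true
anyᵇ⁻ {suc k} f any-f with f Fin.zero in f0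
... | true = Fin.zero , f0
... | false with i , fi ← anyᵇ⁻ (f ∘ Fin.suc) any-f = Fin.suc i , fi

≟-true⁻ : ∀ {n} {a b : Fin n} → ⌊ a ≟ b ⌋ ≡ true → a ≡ b
≟-true⁻ {a = a} {b} e with a ≟ b
... | yes a≡b = a≡b

≟-refl : ∀ {n} (a : Fin n) → ⌊ a ≟ a ⌋ ≡ true
≟-refl a with a ≟ a
... | yes _ = refl
... | no a≢a with () ← a≢a refl

∨-true⁺ˡ : ∀ {a} b → a ≡ true → (a ∨ b) ≡ true
∨-true⁺ˡ b refl = refl

∨-true⁺ʳ : ∀ a {b} → b ≡ true → (a ∨ b) ≡ true
∨-true⁺ʳ true _ = refl
∨-true⁺ʳ false b = b

∈-∪-⁅⁆⁻ : ∀ {n} {X : Subset n} {u v} → u ∈ X ∪ ⁅ v ⁆ → u ≢ v → u ∈ X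
∈-∪-⁅⁆⁻ {X = X} {v = v} u∈ u≢v with x∈p∪q⁻ X ⁅ v ⁆ u∈
... | inj₁ u∈X = u∈X
... | inj₂ u∈⁅v⁆ with () ← u≢v (x∈⁅y⁆⇒x≡y v u∈⁅v⁆)

∩-⊆-absorb : ∀ {n} {S U : Subset n} → ⊤ ∩ S ⊆ U → U ∩ S ≡ ⊤ ∩ S
∩-⊆-absorb {S = S} {U} ⊤∩S⊆U = trans (⊆-antisym (p∩q⊆q U S) S⊆U∩S) (sym (∩-identityˡ S))
  where
  S⊆U∩S : S ⊆ U ∩ S
  S⊆U∩S x∈S = x∈p∩q⁺ (⊤∩S⊆U (x∈p∩q⁺ (∈⊤ , x∈S)) , x∈S)

∩-∪-⁅⁆ : ∀ {n} {X Y : Subset n} {v} → v ∉ X → X ∩ (Y ∪ ⁅ v ⁆) ≡ X ∩ Y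
∩-∪-⁅⁆ {X = X} {Y} {v} v∉X = ⊆-antisym into outof
  where
  outof : X ∩ Y ⊆ X ∩ (Y ∪ ⁅ v ⁆)
  outof x∈ with x∈X , x∈Y ← x∈p∩q⁻ X Y x∈ = x∈p∩q⁺ (x∈X , p⊆p∪q ⁅ v ⁆ x∈Y)

  into : X ∩ (Y ∪ ⁅ v ⁆) ⊆ X ∩ Y
  into x∈ with x∈X , x∈Y∪v ← x∈p∩q⁻ X _ x∈ =
    x∈p∩q⁺ (x∈X , ∈-∪-⁅⁆⁻ x∈Y∪v λ { refl → v∉X x∈X })

module _ (G : Graph) where
  open Graph G using (n; adj; irrefl)

  adj⇒≢ : ∀ {u w} → adj u w ≡ true → u ≢ w
  adj⇒≢ {u} uw refl with () ← trans (sym uw) (irrefl u)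

  simplicial-off-cycle : ∀ {X K v k c} → Clique G K → X ∩ nbhd G v ⊆ K →
    IsInducedCycle G (X ∪ ⁅ v ⁆) k c → ∀ i → c i ≢ v
  simplicial-off-cycle {K = K} {k = k} {c} clique N⊆K (4≤k , c-inj , c∈ , c-adj) i refl
    with j₁ , j₂ , i~j₁ , i~j₂ , j₁≢j₂ , j₁≁j₂ ← cycle-neighbours 4≤k i =
    j₁≁j₂ (proj₁ (c-adj j₁ j₂) (clique _ _ (in-K i~j₁) (in-K i~j₂) (j₁≢j₂ ∘ c-inj j₁ j₂)))
    where
    in-K : ∀ {j} → cycleAdjIdx k i j → c j ∈ K
    in-K {j} i~j = N⊆K (x∈p∩q⁺ (∈-∪-⁅⁆⁻ (c∈ j) (adj⇒≢ ij ∘ sym) , ∈-tabulate⁺ (adj (c i)) ij))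
      where
      ij : adj (c i) (c j) ≡ true
      ij = proj₂ (c-adj i j) i~j

  Chordal-∪-simplicial : ∀ {X K v} → Chordal G X → Clique G K → X ∩ nbhd G v ⊆ K →
    Chordal G (X ∪ ⁅ v ⁆)
  Chordal-∪-simplicial chordal clique N⊆K k c cyc@(4≤k , c-inj , c∈ , c-adj) =
    chordal k c (4≤k , c-inj , (λ i → ∈-∪-⁅⁆⁻ (c∈ i) (simplicial-off-cycle clique N⊆K cyc i)) , c-adj)

  Chordal-∪-nearlySimplicial : ∀ {X K v x} → Clique G K → nbhd G v ≡ K ∪ ⁅ x ⁆ →
    Chordal G X → x ∉ X → Chordal G (X ∪ ⁅ v ⁆)
  Chordal-∪-nearlySimplicial {X} {x = x} clique N≡ chordal x∉X =
    Chordal-∪-simplicial chordal clique λ {u} u∈ →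
      let u∈X , u∈N = x∈p∩q⁻ X _ u∈ in
      ∈-∪-⁅⁆⁻ (subst (u ∈_) N≡ u∈N) λ { refl → x∉X u∈X }

  module _ (k : ℕ) (p : Fin (suc k) → Fin n) where

    ∈-NP⁺ : ∀ {U u} i → u ∈ U → (p i ≡ u ⊎ adj (p i) u ≡ true) → u ∈ NP G U k p
    ∈-NP⁺ {u = u} i u∈U hit =
      x∈p∩q⁺ (u∈U , ∈-tabulate⁺ _ (anyᵇ⁺ (λ j → ⌊ p j ≟ u ⌋ ∨ adj (p j) u) i (near hit)))
      where
      near : p i ≡ u ⊎ adj (p i) u ≡ true → (⌊ p i ≟ u ⌋ ∨ adj (p i) u) ≡ true
      near (inj₁ refl) = ∨-true⁺ˡ _ (≟-refl (p i))
      near (inj₂ iu) = ∨-true⁺ʳ _ iu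

    ∈-VP⁻ : ∀ {u} → u ∈ VP G k p → ∃ λ i → p i ≡ u
    ∈-VP⁻ u∈ with i , e ← anyᵇ⁻ _ (∈-tabulate⁻ _ u∈) = i , ≟-true⁻ e

    VP-neighbour∈NP : ∀ {u w} → u ∈ VP G k p → adj u w ≡ true → w ∈ NP G ⊤ k p
    VP-neighbour∈NP u∈P uw with i , refl ← ∈-VP⁻ u∈P = ∈-NP⁺ i ∈⊤ (inj₂ uw)

    IsInducedFlatPath-restrict : ∀ {U} → NP G ⊤ k p ⊆ U →
      IsInducedFlatPath G ⊤ k p → IsInducedFlatPath G U k p
    IsInducedFlatPath-restrict NP⊆U ((p-inj , _ , p-adj) , flat) =
      (p-inj , (λ i → NP⊆U (∈-NP⁺ i ∈⊤ (inj₁ refl))) , p-adj) ,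
      λ i 1≤i i<k → trans (cong ∣_∣ (∩-⊆-absorb (NP⊆U ∘ nbhd⊆NP i))) (flat i 1≤i i<k)
      where
      nbhd⊆NP : ∀ i → ⊤ ∩ nbhd G (p i) ⊆ NP G ⊤ k p
      nbhd⊆NP i u∈ = ∈-NP⁺ i ∈⊤ (inj₂ (∈-tabulate⁻ _ (proj₂ (x∈p∩q⁻ ⊤ _ u∈))))

    GoodPair-restrict : ∀ {U W₁ W₂} → NP G ⊤ k p ⊆ U →
      GoodPair G ⊤ k p W₁ W₂ → GoodPair G U k p W₁ W₂
    GoodPair-restrict NP⊆U (chordal₁ , chordal₂ , ∩≡ , ∪≡) =
      chordal₁ , chordal₂ , ∩≡ , trans ∪≡ (sym (∩-⊆-absorb NP⊆U))

    Extendable-swap : ∀ {U W₁ W₂} → Extendable G U k p W₁ W₂ → Extendable G U k p W₂ W₁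
    Extendable-swap (X₁ , X₂ , W₁⊆ , W₂⊆ , chordal₁ , chordal₂ , ∩≡ , ∪≡) =
      X₂ , X₁ , W₂⊆ , W₁⊆ , chordal₂ , chordal₁ , trans (∩-comm X₂ X₁) ∩≡ , trans (∪-comm X₂ X₁) ∪≡

    Extendable-∪ʳ : ∀ {U W₁ W₂ v} → v ∉ U → (E : Extendable G U k p W₁ W₂) →
      Chordal G (proj₁ (proj₂ E) ∪ ⁅ v ⁆) → Extendable G (U ∪ ⁅ v ⁆) k p W₁ W₂
    Extendable-∪ʳ {v = v} v∉U (X₁ , X₂ , W₁⊆ , W₂⊆ , chordal₁ , _ , ∩≡ , ∪≡) chordal₂ =
      X₁ , X₂ ∪ ⁅ v ⁆ , W₁⊆ , p⊆p∪q ⁅ v ⁆ ∘ W₂⊆ , chordal₁ , chordal₂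
      , trans (∩-∪-⁅⁆ (v∉U ∘ subst (v ∈_) ∪≡ ∘ p⊆p∪q X₂)) ∩≡
      , trans (sym (∪-assoc X₁ X₂ ⁅ v ⁆)) (cong (_∪ ⁅ v ⁆) ∪≡)

    Extendable-∪-vertex : ∀ {U W₁ W₂ v x} → v ∉ U → x ∉ VP G k p →
      (∀ {X} → Chordal G X → x ∉ X → Chordal G (X ∪ ⁅ v ⁆)) →
      Extendable G U k p W₁ W₂ → Extendable G (U ∪ ⁅ v ⁆) k p W₁ W₂
    Extendable-∪-vertex {x = x} v∉U x∉P add E@(X₁ , X₂ , _ , _ , chordal₁ , chordal₂ , ∩≡ , _)
      with x ∈? X₂
    ... | no x∉X₂ = Extendable-∪ʳ v∉U E (add chordal₂ x∉X₂)
    ... | yes x∈X₂ = Extendable-swap (Extendable-∪ʳ v∉U (Extendable-swap E) (add chordal₁ x∉X₁))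
      where
      x∉X₁ : x ∉ X₁
      x∉X₁ x∈X₁ = x∉P (subst (x ∈_) ∩≡ (x∈p∩q⁺ (x∈X₁ , x∈X₂)))

lemma2p1 : (G : Graph) → MNFPE G →
    (k : ℕ) (p : Fin (suc k) → Fin (Graph.n G)) → WitnessPath G k p →
    (v : Fin (Graph.n G)) → NearlySimplicial G v → v ∈ NP G ⊤ k p
lemma2p1 G (_ , minimal) k p (flat , W₁ , W₂ , good , ¬extendable) v (K , x , clique , N≡) =
  decidable-stable (v ∈? NP G ⊤ k p) (¬extendable ∘ extend)
  where
  v∉U : v ∉ ∁ ⁅ v ⁆
  v∉U = x∈p⇒x∉∁p (x∈⁅x⁆ v)

  v~x : Graph.adj G v x ≡ true
  v~x = ∈-tabulate⁻ _ (subst (x ∈_) (sym N≡) (q⊆p∪q K ⁅ x ⁆ (x∈⁅x⁆ x)))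

  extend : v ∉ NP G ⊤ k p → Extendable G ⊤ k p W₁ W₂
  extend v∉NP = subst (λ S → Extendable G S k p W₁ W₂) (trans (∪-comm _ ⁅ v ⁆) (p∪∁p≡⊤ ⁅ v ⁆))
    (Extendable-∪-vertex G k p v∉U x∉P (Chordal-∪-nearlySimplicial G clique N≡)
      (minimal (∁ ⁅ v ⁆) (v , v∉U) k p (IsInducedFlatPath-restrict G k p NP⊆U flat) W₁ W₂
        (GoodPair-restrict G k p NP⊆U good)))
    where
    NP⊆U : NP G ⊤ k p ⊆ ∁ ⁅ v ⁆
    NP⊆U u∈NP = x∉p⇒x∈∁p (x≢y⇒x∉⁅y⁆ λ { refl → v∉NP u∈NP })

    x∉P : x ∉ VP G k p
    x∉P x∈P = v∉NP (VP-neighbour∈NP G k p x∈P (trans (Graph.sym G x v) v~x))
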